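{- Let $k$ be a field of characteristic $p>0$ with a discrete valuation $v$, and let $$P(T)=\sum_{i=1}^rc_iT_i^{p^m}+\sum_{i=1}^r\sum_{j=1}^{m-1}c_{ij}T_i^{p^{m-j}}+T_1$$ be a $p$-polynomial with coefficients in $k$, where $c_1,\dots,c_r$ is a $k^{p^m}$-valuation basis of $k$. Then there exist constants $\alpha\le\beta$ depending only on $P$ such that for every $a\in k$ for which the set $\{v(a-y)\mid y\in\operatorname{im}P\}$ admits a maximum, this maximum belongs to the segment $[\alpha,\beta]$ or equals $\infty$.
   Context: Here $\operatorname{im}P=P(k\times\cdots\times k)$. For a valued field $(K,v)$, a subfield $L$ and an $L$-subspace $V$ of $K$, a system $(b_i)_{i\in I}$ of nonzero elements of $K$ is $L$-valuation independent if $v(\sum_i a_ib_i)=\min_i v(a_ib_i)$ for all finitely supported families $(a_i)$ in $L$; it is a valuation basis of $V$ if it is a basis of $V$ and $L$-valuation independent. -}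

module Defs where

open import Level using (Level; _⊔_) renaming (suc to lsuc)
open import Algebra.Bundles using (CommutativeRing)
open import Data.Nat as ℕ using (ℕ; zero; suc; _∸_)
open import Data.Integer as ℤ using (ℤ)
open import Data.Fin using (Fin; zero; suc; toℕ)
open import Data.Product using (Σ; ∃; _×_; _,_)
open import Relation.Nullary using (¬_)
open import Relation.Binary.PropositionalEquality using (_≡_)

data ℤ∞ : Set where
  fin : ℤ → ℤ∞
  ∞   : ℤ∞

infix 4 _≤∞_
data _≤∞_ : ℤ∞ → ℤ∞ → Set where
  fin≤fin : ∀ {a b} → a ℤ.≤ b → fin a ≤∞ fin b
  ≤∞-top  : ∀ {x} → x ≤∞ ∞

_+∞_ : ℤ∞ → ℤ∞ → ℤ∞
fin a +∞ fin b = fin (a ℤ.+ b)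
fin _ +∞ ∞     = ∞
∞     +∞ _     = ∞

min∞ : ℤ∞ → ℤ∞ → ℤ∞
min∞ (fin a) (fin b) = fin (a ℤ.⊓ b)
min∞ (fin a) ∞       = fin a
min∞ ∞       y       = y

minOver : ∀ n → (Fin n → ℤ∞) → ℤ∞
minOver zero    f = ∞
minOver (suc n) f = min∞ (f zero) (minOver n (λ i → f (suc i)))

record Field c ℓ : Set (lsuc (c ⊔ ℓ)) where
  field
    commutativeRing : CommutativeRing c ℓ
  open CommutativeRing commutativeRing public
  field
    0≉1     : ¬ (0# ≈ 1#)
    inverse : ∀ x → ¬ (x ≈ 0#) → ∃ λ y → (x * y) ≈ 1#

module _ {c ℓ} (F : Field c ℓ) where
  open Field F using (Carrier; _≈_; _+_; _*_; -_; _-_; 0#; 1#)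

  _·_ : ℕ → Carrier → Carrier
  zero  · x = 0#
  suc n · x = x + (n · x)

  _^_ : Carrier → ℕ → Carrier
  x ^ zero  = 1#
  x ^ suc n = x * (x ^ n)

  ∑ : ∀ n → (Fin n → Carrier) → Carrier
  ∑ zero    f = 0#
  ∑ (suc n) f = f zero + ∑ n (λ i → f (suc i))

  HasCharacteristic : ℕ → Set ℓ
  HasCharacteristic p =
    (0 ℕ.< p) × ((p · 1#) ≈ 0#) × (∀ n → 0 ℕ.< n → n ℕ.< p → ¬ ((n · 1#) ≈ 0#))

  record IsDiscreteValuation (v : Carrier → ℤ∞) : Set (c ⊔ ℓ) where
    field
      v-cong : ∀ {x y} → x ≈ y → v x ≡ v y
      v-zero : v 0# ≡ ∞
      v-∞    : ∀ x → v x ≡ ∞ → x ≈ 0#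
      v-mul  : ∀ x y → v (x * y) ≡ (v x +∞ v y)
      v-add  : ∀ x y → min∞ (v x) (v y) ≤∞ v (x + y)
      v-surj : ∀ (z : ℤ) → ∃ λ x → v x ≡ fin z

  -- (c_i)_{i<r} is a k^q-valuation basis of k, where k^q = {a^q | a ∈ k}:
  -- nonzero elements, a basis of k over k^q, and k^q-valuation independent.
  record IsValuationBasisOverPow (v : Carrier → ℤ∞) (q r : ℕ) (cs : Fin r → Carrier)
         : Set (c ⊔ ℓ) where
    field
      nonzero   : ∀ i → ¬ (cs i ≈ 0#)
      spanning  : ∀ x → ∃ λ (a : Fin r → Carrier) → x ≈ ∑ r (λ i → (a i ^ q) * cs i)
      linIndep  : ∀ (a : Fin r → Carrier) → ∑ r (λ i → (a i ^ q) * cs i) ≈ 0#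
                  → ∀ i → (a i ^ q) ≈ 0#
      valIndep  : ∀ (a : Fin r → Carrier) →
                  v (∑ r (λ i → (a i ^ q) * cs i)) ≡ minOver r (λ i → v ((a i ^ q) * cs i))

  -- The p-polynomial map P : k^r → k (r = suc n), with j ranging over 1..m-1
  -- encoded by Fin (m ∸ 1) via j = toℕ j' + 1.
  pPoly : (p m n : ℕ) → (cs : Fin (suc n) → Carrier)
          → (cc : Fin (suc n) → Fin (m ∸ 1) → Carrier)
          → (Fin (suc n) → Carrier) → Carrier
  pPoly p m n cs cc t =
    (∑ (suc n) (λ i → cs i * (t i ^ (p ℕ.^ m)))
      + ∑ (suc n) (λ i → ∑ (m ∸ 1) (λ j → cc i j * (t i ^ (p ℕ.^ (m ∸ suc (toℕ j)))))))
    + t zero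

  IsMaxValue : ∀ {a} {A : Set a} (v : Carrier → ℤ∞) (P : A → Carrier) (x : Carrier) (μ : ℤ∞) → Set a
  IsMaxValue v P x μ = (∃ λ t → v (x - P t) ≡ μ) × (∀ t → v (x - P t) ≤∞ μ)

module Submission where

-- Let P(T) = Σ cᵢ Tᵢ^q + Σᵢⱼ cᵢⱼ Tᵢ^(p^(m-j)) + T₁ with q = p^m, and let K bound
-- |v| of all coefficients. In characteristic p, P is additive (Frobenius), so if
-- μ = v(a - P s) is maximal then v(b - P t) ≤ μ for b = a - P s and every t.
-- A finite μ = v b outside [-3(K+1), K+1] contradicts this:
--   * if z = v b ≥ K+1, then b - P(b,0,…,0) is minus a sum of monomials c·b^E
--     with E ≥ 2, each of valuation ≥ -K + 2z > z;
--   * if z = v b ≤ -3(K+1), write b = Σ aᵢ^q cᵢ; valuation independence gives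
--     v(aᵢ^q cᵢ) ≥ z, and b - P a = -(Σ cᵢⱼ aᵢ^(p^(m-j)) + a₁) has valuation > z
--     since 2·p^(m-j) ≤ q.

open import Defs hiding (_^_; _·_)
open import Data.Nat as ℕ using (ℕ; zero; suc; z≤n; s≤s; _∸_)
import Data.Nat.Properties as ℕP
open import Data.Nat.Combinatorics using (_C_; nCn≡1; nC1≡n; k>n⇒nCk≡0; nCk+nC[k+1]≡[n+1]C[k+1])
open import Data.Integer as ℤ using (ℤ; +_; 0ℤ; +≤+)
import Data.Integer.Properties as ℤP
import Data.Integer.Tactic.RingSolver as ℤ-Solver
open import Data.Fin using (Fin; zero; suc; toℕ; fromℕ; inject₁)
open import Data.Fin.Properties using (toℕ-fromℕ; toℕ-inject₁; toℕ<n)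
open import Data.Product using (∃; _×_; _,_; proj₁; proj₂)
open import Data.Sum using (_⊎_; inj₁; inj₂)
open import Data.Empty using (⊥-elim)
open import Relation.Nullary using (¬_)
open import Relation.Binary.PropositionalEquality as ≡ using (_≡_)
open import Data.Maybe using (nothing)
open import Algebra.Bundles using (CommutativeRing)
import Tactic.RingSolver as Ring-Solver
open import Tactic.RingSolver.Core.AlmostCommutativeRing using (AlmostCommutativeRing; fromCommutativeRing)

≤∞-refl : ∀ {x} → x ≤∞ x
≤∞-refl {fin a} = fin≤fin ℤP.≤-refl
≤∞-refl {∞}     = ≤∞-top

≤∞-trans : ∀ {x y z} → x ≤∞ y → y ≤∞ z → x ≤∞ z
≤∞-trans (fin≤fin a≤b) (fin≤fin b≤c) = fin≤fin (ℤP.≤-trans a≤b b≤c)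
≤∞-trans _             ≤∞-top        = ≤∞-top

fin-≤∞⁻¹ : ∀ {a b} → fin a ≤∞ fin b → a ℤ.≤ b
fin-≤∞⁻¹ (fin≤fin a≤b) = a≤b

min∞-greatest : ∀ {a x y} → fin a ≤∞ x → fin a ≤∞ y → fin a ≤∞ min∞ x y
min∞-greatest {x = fin _} {fin _} (fin≤fin a≤x) (fin≤fin a≤y) = fin≤fin (ℤP.⊓-glb a≤x a≤y)
min∞-greatest {x = fin _} {∞}     a≤x _   = a≤x
min∞-greatest {x = ∞}             _   a≤y = a≤y

min∞-≤ˡ : ∀ x y → min∞ x y ≤∞ x
min∞-≤ˡ (fin a) (fin b) = fin≤fin (ℤP.i⊓j≤i a b)
min∞-≤ˡ (fin a) ∞       = ≤∞-refl
min∞-≤ˡ ∞       y       = ≤∞-top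

min∞-≤ʳ : ∀ x y → min∞ x y ≤∞ y
min∞-≤ʳ (fin a) (fin b) = fin≤fin (ℤP.i⊓j≤j a b)
min∞-≤ʳ (fin a) ∞       = ≤∞-top
min∞-≤ʳ ∞       y       = ≤∞-refl

minOver-≤ : ∀ n (f : Fin n → ℤ∞) i → minOver n f ≤∞ f i
minOver-≤ (suc n) f zero    = min∞-≤ˡ _ _
minOver-≤ (suc n) f (suc i) = ≤∞-trans (min∞-≤ʳ _ _) (minOver-≤ n (λ j → f (suc j)) i)

+∞-absorbʳ : ∀ x → x +∞ ∞ ≡ ∞
+∞-absorbʳ (fin _) = ≡.refl
+∞-absorbʳ ∞       = ≡.refl

+∞-identityˡ : ∀ x → fin 0ℤ +∞ x ≡ x
+∞-identityˡ (fin a) = ≡.cong fin (ℤP.+-identityˡ a)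
+∞-identityˡ ∞       = ≡.refl

fin-injective : ∀ {a b} → fin a ≡ fin b → a ≡ b
fin-injective ≡.refl = ≡.refl

+∞-idempotent : ∀ x → x ≡ x +∞ x → x ≡ fin 0ℤ ⊎ x ≡ ∞
+∞-idempotent ∞       _     = inj₂ ≡.refl
+∞-idempotent (fin a) a≡a+a = inj₁ (≡.cong fin (begin
  a            ≡⟨ identity a ⟩
  (a ℤ.+ a) ℤ.- a ≡⟨ ≡.cong (ℤ._- a) (fin-injective a≡a+a) ⟨
  a ℤ.- a      ≡⟨ ℤP.+-inverseʳ a ⟩
  0ℤ           ∎))
  where
  open ≡.≡-Reasoning
  identity : ∀ a → a ≡ (a ℤ.+ a) ℤ.- a
  identity = ℤ-Solver.solve-∀

+∞-halve-0 : ∀ x → x +∞ x ≡ fin 0ℤ → x ≡ fin 0ℤ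
+∞-halve-0 (fin a) a+a≡0 = ≡.cong fin (ℤP.*-cancelʳ-≡ a 0ℤ (+ 2)
  (≡.trans (identity a) (fin-injective a+a≡0)))
  where
  identity : ∀ a → a ℤ.* + 2 ≡ a ℤ.+ a
  identity = ℤ-Solver.solve-∀
+∞-halve-0 ∞ ()

-- Linear integer inequalities are proved by certificates: the ring solver
-- identifies y - x with a combination of manifestly nonnegative terms.

≤-by-certificate : ∀ {x y} s → 0ℤ ℤ.≤ s → s ≡ y ℤ.- x → x ℤ.≤ y
≤-by-certificate s 0≤s s≡y-x = ℤP.0≤i-j⇒j≤i (≡.subst (0ℤ ℤ.≤_) s≡y-x 0≤s)

0≤+ : ∀ n → 0ℤ ℤ.≤ + n
0≤+ n = +≤+ z≤n

0≤-+ : ∀ {a b} → 0ℤ ℤ.≤ a → 0ℤ ℤ.≤ b → 0ℤ ℤ.≤ a ℤ.+ b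
0≤-+ = ℤP.+-mono-≤

0≤-* : ∀ {a b} → 0ℤ ℤ.≤ a → 0ℤ ℤ.≤ b → 0ℤ ℤ.≤ a ℤ.* b
0≤-* {a} {b} 0≤a 0≤b =
  ≡.subst (ℤ._≤ a ℤ.* b) (ℤP.*-zeroʳ a) (ℤP.*-monoˡ-≤-nonNeg a {{ℤ.nonNegative 0≤a}} 0≤b)

0≤-diff : ∀ {a b} → a ℤ.≤ b → 0ℤ ℤ.≤ b ℤ.- a
0≤-diff = ℤP.i≤j⇒0≤j-i

z+1≰z : ∀ z → ¬ (z ℤ.+ + 1 ℤ.≤ z)
z+1≰z z z+1≤z = 0≰-1 (≡.subst (0ℤ ℤ.≤_) (identity z) (0≤-diff z+1≤z))
  where
  identity : ∀ z → z ℤ.- (z ℤ.+ + 1) ≡ ℤ.- + 1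
  identity = ℤ-Solver.solve-∀
  0≰-1 : ¬ (0ℤ ℤ.≤ ℤ.- + 1)
  0≰-1 ()

-- The segment [lowerThreshold K, upperThreshold K] = [-3(K+1), K+1] of the
-- theorem, where K bounds |v| of all coefficients of P.

lowerThreshold : ℕ → ℤ
lowerThreshold K = ℤ.- (+ 3 ℤ.* (+ K ℤ.+ + 1))

upperThreshold : ℕ → ℤ
upperThreshold K = + K ℤ.+ + 1

thresholds-ordered : ∀ K → lowerThreshold K ℤ.≤ upperThreshold K
thresholds-ordered K =
  ≤-by-certificate (+ 4 ℤ.* (+ K ℤ.+ + 1)) (0≤-* (0≤+ 4) (0≤-+ (0≤+ K) (0≤+ 1))) (identity (+ K))
  where
  identity : ∀ k → + 4 ℤ.* (k ℤ.+ + 1) ≡ (k ℤ.+ + 1) ℤ.- ℤ.- (+ 3 ℤ.* (k ℤ.+ + 1))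
  identity = ℤ-Solver.solve-∀

-- Above the upper threshold: a coefficient of valuation δ ≥ -K times an
-- E-th power (E ≥ 2) of an element of valuation w ≥ z gains at least 1 over z.
upper-estimate : ∀ K {E z w δ} → + 2 ℤ.≤ E → upperThreshold K ℤ.≤ z → z ℤ.≤ w →
                 ℤ.- + K ℤ.≤ δ → z ℤ.+ + 1 ℤ.≤ δ ℤ.+ E ℤ.* w
upper-estimate K {E} {z} {w} {δ} 2≤E K<z z≤w -K≤δ = ≤-by-certificate _
  (0≤-+ (0≤-+ (0≤-+ (0≤-diff -K≤δ) (0≤-* (0≤-diff 2≤E) 0≤w)) (0≤-diff z≤w)) (0≤-diff K<w))
  (identity δ E z w (+ K))
  where
  K<w : upperThreshold K ℤ.≤ w
  K<w = ℤP.≤-trans K<z z≤w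
  0≤w : 0ℤ ℤ.≤ w
  0≤w = ℤP.≤-trans (0≤-+ (0≤+ K) (0≤+ 1)) K<w
  identity : ∀ δ E z w k → (δ ℤ.- ℤ.- k) ℤ.+ (E ℤ.- + 2) ℤ.* w ℤ.+ (w ℤ.- z) ℤ.+ (w ℤ.- (k ℤ.+ + 1))
                           ≡ (δ ℤ.+ E ℤ.* w) ℤ.- (z ℤ.+ + 1)
  identity = ℤ-Solver.solve-∀

-- Below the lower threshold: if q·w + γ ≥ z with γ ≤ K (w the valuation of a
-- base, q·w + γ that of a term a^q c_i), then a coefficient of valuation
-- δ ≥ -K times the E-th power of the base, 2E ≤ q, gains at least 1 over z.
lower-estimate : ∀ K {E q z w γ δ} → 0ℤ ℤ.≤ E → + 2 ℤ.* E ℤ.≤ q → z ℤ.≤ q ℤ.* w ℤ.+ γ →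
                 γ ℤ.≤ + K → ℤ.- + K ℤ.≤ δ → z ℤ.≤ lowerThreshold K → z ℤ.+ + 1 ℤ.≤ δ ℤ.+ E ℤ.* w
lower-estimate K {E} {q} {z} {w} {γ} {δ} 0≤E 2E≤q z≤qw+γ γ≤K -K≤δ z≤α with ℤP.≤-total 0ℤ w
... | inj₁ 0≤w = ≤-by-certificate _
  (0≤-+ (0≤-+ (0≤-+ (0≤-diff -K≤δ) (0≤-* 0≤E 0≤w)) (0≤-diff z≤α)) (0≤-+ (0≤+ 2) (0≤-* (0≤+ 2) (0≤+ K))))
  (identity δ E z w (+ K))
  where
  identity : ∀ δ E z w k → (δ ℤ.- ℤ.- k) ℤ.+ E ℤ.* w ℤ.+ (ℤ.- (+ 3 ℤ.* (k ℤ.+ + 1)) ℤ.- z)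
                           ℤ.+ (+ 2 ℤ.+ + 2 ℤ.* k) ≡ (δ ℤ.+ E ℤ.* w) ℤ.- (z ℤ.+ + 1)
  identity = ℤ-Solver.solve-∀
... | inj₂ w≤0 = ℤP.*-cancelʳ-≤-pos _ _ (+ 2) (≤-by-certificate _
  (0≤-+ (0≤-+ (0≤-+ (0≤-+ (0≤-+ (0≤-* (0≤+ 2) (0≤-diff -K≤δ)) (0≤-* (0≤-diff 2E≤q) (0≤-diff w≤0)))
     (0≤-diff z≤qw+γ)) (0≤-diff γ≤K)) (0≤-diff z≤α)) (0≤+ 1))
  (identity δ E q z w γ (+ K)))
  where
  identity : ∀ δ E q z w γ k →
    + 2 ℤ.* (δ ℤ.- ℤ.- k) ℤ.+ (q ℤ.- + 2 ℤ.* E) ℤ.* (0ℤ ℤ.- w) ℤ.+ (q ℤ.* w ℤ.+ γ ℤ.- z) ℤ.+ (k ℤ.- γ)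
      ℤ.+ (ℤ.- (+ 3 ℤ.* (k ℤ.+ + 1)) ℤ.- z) ℤ.+ + 1
    ≡ (δ ℤ.+ E ℤ.* w) ℤ.* + 2 ℤ.- (z ℤ.+ + 1) ℤ.* + 2
  identity = ℤ-Solver.solve-∀

finite-bound : ∀ n (g : Fin n → ℕ) → ∃ λ M → ∀ i → g i ℕ.≤ M
finite-bound zero    g = 0 , λ ()
finite-bound (suc n) g with finite-bound n (λ i → g (suc i))
... | M , bounded = g zero ℕ.⊔ M , λ where
  zero    → ℕP.m≤m⊔n (g zero) M
  (suc i) → ℕP.≤-trans (bounded i) (ℕP.m≤n⊔m (g zero) M)

∣_∣∞ : ℤ∞ → ℕ
∣ fin a ∣∞ = ℤ.∣ a ∣
∣ ∞ ∣∞     = 0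

∣∣≤⇒≥- : ∀ {K} x → ∣ x ∣∞ ℕ.≤ K → fin (ℤ.- + K) ≤∞ x
∣∣≤⇒≥- (fin (+ a))     _           = fin≤fin (ℤP.≤-trans (ℤP.neg-mono-≤ (0≤+ _)) (0≤+ a))
∣∣≤⇒≥- {suc K} (fin ℤ.-[1+ a ]) (s≤s a≤K) = fin≤fin (ℤ.-≤- a≤K)
∣∣≤⇒≥- ∞               _           = ≤∞-top

∣∣≤⇒≤ : ∀ {K a} → ℤ.∣ a ∣ ℕ.≤ K → a ℤ.≤ + K
∣∣≤⇒≤ {a = + a}        a≤K = +≤+ a≤K
∣∣≤⇒≤ {a = ℤ.-[1+ a ]} _   = ℤ.-≤+

choose-absorption : ∀ n k → suc k ℕ.* (suc n C suc k) ≡ suc n ℕ.* (n C k)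
choose-absorption zero zero = ≡.refl
choose-absorption zero (suc k)
  rewrite k>n⇒nCk≡0 {1} {suc (suc k)} (s≤s (s≤s z≤n)) | k>n⇒nCk≡0 {0} {suc k} (s≤s z≤n)
  = ℕP.*-zeroʳ (suc (suc k))
choose-absorption (suc n) zero rewrite nC1≡n (suc (suc n)) =
  ≡.trans (ℕP.+-identityʳ (suc (suc n))) (≡.sym (ℕP.*-identityʳ (suc (suc n))))
choose-absorption (suc n) (suc k) = begin
  suc (suc k) ℕ.* (suc (suc n) C suc (suc k))
    ≡⟨ ≡.cong (suc (suc k) ℕ.*_) (≡.sym (nCk+nC[k+1]≡[n+1]C[k+1] (suc n) (suc k))) ⟩
  suc (suc k) ℕ.* (A ℕ.+ B)
    ≡⟨ ℕP.*-distribˡ-+ (suc (suc k)) A B ⟩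
  (A ℕ.+ suc k ℕ.* A) ℕ.+ suc (suc k) ℕ.* B
    ≡⟨ ≡.cong₂ (λ u w → (A ℕ.+ u) ℕ.+ w) (choose-absorption n k) (choose-absorption n (suc k)) ⟩
  (A ℕ.+ suc n ℕ.* (n C k)) ℕ.+ suc n ℕ.* (n C suc k)
    ≡⟨ ℕP.+-assoc A _ _ ⟩
  A ℕ.+ (suc n ℕ.* (n C k) ℕ.+ suc n ℕ.* (n C suc k))
    ≡⟨ ≡.cong (A ℕ.+_) (≡.sym (ℕP.*-distribˡ-+ (suc n) (n C k) (n C suc k))) ⟩
  A ℕ.+ suc n ℕ.* (n C k ℕ.+ n C suc k)
    ≡⟨ ≡.cong (λ u → A ℕ.+ suc n ℕ.* u) (nCk+nC[k+1]≡[n+1]C[k+1] n k) ⟩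
  suc (suc n) ℕ.* A ∎
  where
  open ≡.≡-Reasoning
  A = suc n C suc k
  B = suc n C suc (suc k)

-- Exponent bookkeeping for powers of a base p > 1: the exponents p^(m-j)
-- occurring in P are ≥ 1, are ≥ 2 for j < m, and at most half of p^m.
module PowersOf (p : ℕ) (1<p : 1 ℕ.< p) where

  2≤pow : ∀ k → 0 ℕ.< k → 2 ℕ.≤ p ℕ.^ k
  2≤pow k 0<k = ℕP.^-monoʳ-< p 1<p 0<k

  1≤pow : ∀ k → 1 ℕ.≤ p ℕ.^ k
  1≤pow zero    = ℕP.≤-refl
  1≤pow (suc k) = ℕP.≤-trans (s≤s z≤n) (2≤pow (suc k) (s≤s z≤n))

  -- p^(m+1) = p^(t+1)·p^(m-t) ≥ 2·p^(m-t)
  double-pow≤ : ∀ {t m} → t ℕ.≤ m → 2 ℕ.* p ℕ.^ (m ∸ t) ℕ.≤ p ℕ.^ suc m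
  double-pow≤ {t} {m} t≤m = begin
    2 ℕ.* p ℕ.^ (m ∸ t)             ≤⟨ ℕP.*-monoˡ-≤ (p ℕ.^ (m ∸ t)) (2≤pow (suc t) (s≤s z≤n)) ⟩
    p ℕ.^ suc t ℕ.* p ℕ.^ (m ∸ t)   ≡⟨ ℕP.^-distribˡ-+-* p (suc t) (m ∸ t) ⟨
    p ℕ.^ (suc t ℕ.+ (m ∸ t))       ≡⟨ ≡.cong (λ e → p ℕ.^ suc e) (ℕP.m+[n∸m]≡n t≤m) ⟩
    p ℕ.^ suc m                     ∎
    where open ℕP.≤-Reasoning

module FieldFacts {c ℓ} (F : Field c ℓ) where
  open Field F hiding (zero)
  open import Algebra.Properties.Semiring.Mult semiring
    using (×1-homo-*; ×-assoc-*; ×-congʳ) renaming (_×_ to _×ₛ_)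
  open import Algebra.Properties.Semiring.Exp semiring
    using (^-congˡ; ^-assocʳ) renaming (_^_ to _^ₛ_)
  open import Algebra.Properties.CommutativeMonoid.Sum +-commutativeMonoid
    using (sum; sum-cong-≋; sum-init-last; sum-replicate-zero; ∑-distrib-+)
  import Algebra.Properties.CommutativeSemiring.Binomial commutativeSemiring as Binomial
  open import Relation.Binary.Reasoning.Setoid setoid

  infixr 8 _^_
  _^_ : Carrier → ℕ → Carrier
  x ^ n = Defs._^_ F x n

  ^≡^ₛ : ∀ x n → x ^ n ≡ x ^ₛ n
  ^≡^ₛ x zero    = ≡.refl
  ^≡^ₛ x (suc n) = ≡.cong (x *_) (^≡^ₛ x n)

  ·≡×ₛ : ∀ n x → Defs._·_ F n x ≡ n ×ₛ x
  ·≡×ₛ zero    x = ≡.refl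
  ·≡×ₛ (suc n) x = ≡.cong (_+_ x) (·≡×ₛ n x)

  ^-cong : ∀ {x y} n → x ≈ y → x ^ n ≈ y ^ n
  ^-cong {x} {y} n x≈y rewrite ^≡^ₛ x n | ^≡^ₛ y n = ^-congˡ n x≈y

  ^-* : ∀ x a b → x ^ (a ℕ.* b) ≈ (x ^ a) ^ b
  ^-* x a b rewrite ^≡^ₛ x (a ℕ.* b) | ^≡^ₛ (x ^ a) b | ^≡^ₛ x a = sym (^-assocʳ x a b)

  ∑≡sum : ∀ k (f : Fin k → Carrier) → ∑ F k f ≡ sum f
  ∑≡sum zero    f = ≡.refl
  ∑≡sum (suc k) f = ≡.cong (_+_ (f zero)) (∑≡sum k (λ i → f (suc i)))

  ∑-cong : ∀ k (f g : Fin k → Carrier) → (∀ i → f i ≈ g i) → ∑ F k f ≈ ∑ F k g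
  ∑-cong k f g f≈g rewrite ∑≡sum k f | ∑≡sum k g = sum-cong-≋ f≈g

  ∑-split : ∀ k (f g h : Fin k → Carrier) → (∀ i → h i ≈ f i + g i) → ∑ F k h ≈ ∑ F k f + ∑ F k g
  ∑-split k f g h h≈f+g rewrite ∑≡sum k f | ∑≡sum k g | ∑≡sum k h =
    trans (sum-cong-≋ h≈f+g) (∑-distrib-+ f g)

  cancelˡ : ∀ x y → ¬ (x ≈ 0#) → x * y ≈ 0# → y ≈ 0#
  cancelˡ x y x≉0 xy≈0 with inverse x x≉0
  ... | x⁻¹ , xx⁻¹≈1 = begin
    y              ≈⟨ *-identityˡ y ⟨
    1# * y         ≈⟨ *-congʳ (trans (sym xx⁻¹≈1) (*-comm x x⁻¹)) ⟩
    (x⁻¹ * x) * y  ≈⟨ *-assoc x⁻¹ x y ⟩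
    x⁻¹ * (x * y)  ≈⟨ *-congˡ xy≈0 ⟩
    x⁻¹ * 0#       ≈⟨ zeroʳ x⁻¹ ⟩
    0#             ∎

  characteristic>1 : ∀ {p} → HasCharacteristic F p → 1 ℕ.< p
  characteristic>1 {zero}        (() , _)
  characteristic>1 {suc zero}    (_ , 1·1≈0 , _) = ⊥-elim (0≉1 (sym (trans (sym (+-identityʳ 1#)) 1·1≈0)))
  characteristic>1 {suc (suc _)} _ = s≤s (s≤s z≤n)

  -- C(p,k) = 0 in F for 0 < k < p: k·C(p,k) = p·C(p-1,k-1) vanishes and k ≠ 0 in F.
  choose-vanishes : ∀ {p} → HasCharacteristic F p → ∀ {k} → 0 ℕ.< k → k ℕ.< p → (p C k) ×ₛ 1# ≈ 0#
  choose-vanishes {suc p'} (_ , p·1≈0 , small≉0) {suc k} 0<k k<p = cancelˡ _ _ k·1≉0 (begin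
    (suc k ×ₛ 1#) * ((suc p' C suc k) ×ₛ 1#) ≈⟨ ×1-homo-* (suc k) (suc p' C suc k) ⟨
    (suc k ℕ.* (suc p' C suc k)) ×ₛ 1#      ≡⟨ ≡.cong (_×ₛ 1#) (choose-absorption p' k) ⟩
    (suc p' ℕ.* (p' C k)) ×ₛ 1#              ≈⟨ ×1-homo-* (suc p') (p' C k) ⟩
    (suc p' ×ₛ 1#) * ((p' C k) ×ₛ 1#)        ≈⟨ *-congʳ (≡.subst (_≈ 0#) (·≡×ₛ (suc p') 1#) p·1≈0) ⟩
    0# * ((p' C k) ×ₛ 1#)                    ≈⟨ zeroˡ _ ⟩
    0#                                        ∎)
    where
    k·1≉0 : ¬ (suc k ×ₛ 1# ≈ 0#)
    k·1≉0 = ≡.subst (λ e → ¬ (e ≈ 0#)) (·≡×ₛ (suc k) 1#) (small≉0 (suc k) 0<k k<p)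

  -- Frobenius: (x + y)^p = x^p + y^p, since all middle binomial terms vanish.
  frobenius : ∀ {p} → HasCharacteristic F p → ∀ x y → (x + y) ^ p ≈ x ^ p + y ^ p
  frobenius {p} char x y with characteristic>1 char
  ... | s≤s (s≤s {n = p'} z≤n) = begin
    (x + y) ^ p                                     ≡⟨ ^≡^ₛ (x + y) p ⟩
    (x + y) ^ₛ p                                    ≈⟨ Binomial.theorem p x y ⟩
    term zero + sum (λ i → term (suc i))            ≈⟨ +-congˡ (sum-init-last (λ i → term (suc i))) ⟩
    term zero + (sum (λ i → term (suc (inject₁ i))) + term (suc (fromℕ (suc p'))))
                                                    ≈⟨ +-cong first (+-cong middle (last (toℕ-fromℕ (suc p')))) ⟩
    y ^ p + (0# + x ^ p)                            ≈⟨ +-congˡ (+-identityˡ (x ^ p)) ⟩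
    y ^ p + x ^ p                                   ≈⟨ +-comm (y ^ p) (x ^ p) ⟩
    x ^ p + y ^ p                                   ∎
    where
    term : Fin (suc p) → Carrier
    term = Binomial.binomialTerm x y p

    first : term zero ≈ y ^ p
    first = begin
      1# * (y ^ₛ p) + 0# ≈⟨ +-identityʳ _ ⟩
      1# * (y ^ₛ p)      ≈⟨ *-identityˡ _ ⟩
      y ^ₛ p             ≡⟨ ^≡^ₛ y p ⟨
      y ^ p              ∎

    middle-term : ∀ (i : Fin (suc p')) → term (suc (inject₁ i)) ≈ 0#
    middle-term i = begin
      (p C k) ×ₛ z          ≈⟨ ×-congʳ (p C k) (*-identityˡ z) ⟨
      (p C k) ×ₛ (1# * z)   ≈⟨ ×-assoc-* (p C k) 1# z ⟨
      ((p C k) ×ₛ 1#) * z   ≈⟨ *-congʳ (choose-vanishes char (s≤s z≤n) k<p) ⟩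
      0# * z                ≈⟨ zeroˡ z ⟩
      0#                    ∎
      where
      k = suc (toℕ (inject₁ i))
      z = (x ^ₛ k) * (y ^ₛ (p ∸ k))
      k<p : k ℕ.< p
      k<p = s≤s (≡.subst (ℕ._< suc p') (≡.sym (toℕ-inject₁ i)) (toℕ<n i))

    middle : sum (λ i → term (suc (inject₁ i))) ≈ 0#
    middle = trans (sum-cong-≋ middle-term) (sum-replicate-zero (suc p'))

    last : ∀ {j} → j ≡ suc p' → (p C suc j) ×ₛ ((x ^ₛ suc j) * (y ^ₛ (p ∸ suc j))) ≈ x ^ p
    last ≡.refl = begin
      (p C p) ×ₛ ((x ^ₛ p) * (y ^ₛ (p ∸ p))) ≡⟨ ≡.cong₂ (λ a b → a ×ₛ ((x ^ₛ p) * (y ^ₛ b))) (nCn≡1 p) (ℕP.n∸n≡0 p) ⟩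
      (x ^ₛ p) * 1# + 0#                    ≈⟨ +-identityʳ _ ⟩
      (x ^ₛ p) * 1#                         ≈⟨ *-identityʳ _ ⟩
      x ^ₛ p                                ≡⟨ ^≡^ₛ x p ⟨
      x ^ p                                 ∎

  frobenius-pow : ∀ {p} → HasCharacteristic F p → ∀ k x y →
                  (x + y) ^ (p ℕ.^ k) ≈ x ^ (p ℕ.^ k) + y ^ (p ℕ.^ k)
  frobenius-pow char zero    x y = trans (*-identityʳ (x + y)) (sym (+-cong (*-identityʳ x) (*-identityʳ y)))
  frobenius-pow {p} char (suc k) x y = begin
    (x + y) ^ (p ℕ.* q)           ≈⟨ ^-* (x + y) p q ⟩
    ((x + y) ^ p) ^ q             ≈⟨ ^-cong q (frobenius char x y) ⟩
    (x ^ p + y ^ p) ^ q           ≈⟨ frobenius-pow char k (x ^ p) (y ^ p) ⟩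
    (x ^ p) ^ q + (y ^ p) ^ q     ≈⟨ +-cong (^-* x p q) (^-* y p q) ⟨
    x ^ (p ℕ.* q) + y ^ (p ℕ.* q) ∎
    where q = p ℕ.^ k

-- Identities of commutative rings used to rearrange P. Pure rearrangements are
-- left to the ring solver; identities involving cancellation or constants are
-- derived from the group and ring laws, since without a decidable equality on
-- the coefficients the solver cannot simplify them.
module RingIdentities {c ℓ} (R : CommutativeRing c ℓ) where
  private
    solverRing : AlmostCommutativeRing c ℓ
    solverRing = fromCommutativeRing R (λ _ → nothing)

    module Solved where
      open AlmostCommutativeRing solverRing
      interchange₃ : ∀ a b c d e f → ((a + b) + (c + d)) + (e + f) ≈ ((a + c) + e) + ((b + d) + f)
      interchange₃ = Ring-Solver.solve-∀ solverRing
      sub-sum : ∀ a x y → a - (x + y) ≈ (a - x) - y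
      sub-sum = Ring-Solver.solve-∀ solverRing

  open CommutativeRing R
  open import Algebra.Properties.Ring ring using (-1*x≈-x)
  open import Algebra.Properties.AbelianGroup +-abelianGroup using (xyx⁻¹≈y; ⁻¹-anti-homo-∙; ⁻¹-involutive)
  open import Relation.Binary.Reasoning.Setoid setoid

  interchange₃ : ∀ a b c d e f → ((a + b) + (c + d)) + (e + f) ≈ ((a + c) + e) + ((b + d) + f)
  interchange₃ = Solved.interchange₃

  sub-sum : ∀ a x y → a - (x + y) ≈ (a - x) - y
  sub-sum = Solved.sub-sum

  as-monomial : ∀ x → x ≈ 1# * (x * 1#)
  as-monomial x = sym (trans (*-identityˡ (x * 1#)) (*-identityʳ x))

  sub-add-cancel : ∀ x w → x - (x + w) ≈ - w
  sub-add-cancel x w = begin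
    x - (x + w)         ≈⟨ +-congˡ (⁻¹-anti-homo-∙ x w) ⟩
    x + (- w + - x)     ≈⟨ +-assoc x (- w) (- x) ⟨
    (x + - w) + - x     ≈⟨ xyx⁻¹≈y x (- w) ⟩
    - w                 ∎

  sub-cancelˡ : ∀ x y z → x - ((x + y) + z) ≈ - (y + z)
  sub-cancelˡ x y z = trans (+-congˡ (-‿cong (+-assoc x y z))) (sub-add-cancel x (y + z))

  sub-cancelʳ : ∀ x y z → z - ((x + y) + z) ≈ - (x + y)
  sub-cancelʳ x y z = trans (+-congˡ (-‿cong (+-comm (x + y) z))) (sub-add-cancel z (x + y))

  neg-as-product : ∀ x → - x ≈ (- 1#) * x
  neg-as-product x = sym (-1*x≈-x x)

  neg-one-squared : (- 1#) * (- 1#) ≈ 1#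
  neg-one-squared = trans (-1*x≈-x (- 1#)) (⁻¹-involutive 1#)

module ValuationFacts {c ℓ} (F : Field c ℓ) (v : Field.Carrier F → ℤ∞)
                      (valuation : IsDiscreteValuation F v) where
  open Field F hiding (zero)
  open IsDiscreteValuation valuation
  open FieldFacts F using (_^_)
  open RingIdentities commutativeRing using (neg-as-product; neg-one-squared)

  v-1 : v 1# ≡ fin 0ℤ
  v-1 with +∞-idempotent (v 1#) (≡.trans (v-cong (sym (*-identityˡ 1#))) (v-mul 1# 1#))
  ... | inj₁ v1≡0 = v1≡0
  ... | inj₂ v1≡∞ = ⊥-elim (0≉1 (sym (v-∞ 1# v1≡∞)))

  v-neg : ∀ x → v (- x) ≡ v x
  v-neg x = begin
    v (- x)                ≡⟨ v-cong (neg-as-product x) ⟩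
    v ((- 1#) * x)         ≡⟨ v-mul (- 1#) x ⟩
    v (- 1#) +∞ v x        ≡⟨ ≡.cong (_+∞ v x) v-[-1] ⟩
    fin 0ℤ +∞ v x          ≡⟨ +∞-identityˡ (v x) ⟩
    v x                    ∎
    where
    open ≡.≡-Reasoning
    v-[-1] : v (- 1#) ≡ fin 0ℤ
    v-[-1] = +∞-halve-0 (v (- 1#))
      (≡.trans (≡.sym (v-mul (- 1#) (- 1#))) (≡.trans (v-cong neg-one-squared) v-1))

  v-pow : ∀ x {w} e → v x ≡ fin w → v (x ^ e) ≡ fin (+ e ℤ.* w)
  v-pow x {w} zero    _      = ≡.trans v-1 (≡.cong fin (≡.sym (ℤP.*-zeroˡ w)))
  v-pow x {w} (suc e) vx≡w = begin
    v (x * x ^ e)          ≡⟨ v-mul x (x ^ e) ⟩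
    v x +∞ v (x ^ e)       ≡⟨ ≡.cong₂ _+∞_ vx≡w (v-pow x e vx≡w) ⟩
    fin (w ℤ.+ + e ℤ.* w)  ≡⟨ ≡.cong fin (identity (+ e) w) ⟩
    fin (+ suc e ℤ.* w)    ∎
    where
    open ≡.≡-Reasoning
    identity : ∀ e w → w ℤ.+ e ℤ.* w ≡ (+ 1 ℤ.+ e) ℤ.* w
    identity = ℤ-Solver.solve-∀

  v-pow-∞ : ∀ x e → v x ≡ ∞ → v (x ^ suc e) ≡ ∞
  v-pow-∞ x e vx≡∞ = ≡.trans (v-mul x (x ^ e)) (≡.cong (_+∞ v (x ^ e)) vx≡∞)

  _≥ᵥ_ : Carrier → ℤ → Set
  x ≥ᵥ L = fin L ≤∞ v x

  ≥ᵥ-cong : ∀ {L x y} → x ≈ y → x ≥ᵥ L → y ≥ᵥ L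
  ≥ᵥ-cong {L} x≈y = ≡.subst (fin L ≤∞_) (v-cong x≈y)

  ≥ᵥ-+ : ∀ {L x y} → x ≥ᵥ L → y ≥ᵥ L → (x + y) ≥ᵥ L
  ≥ᵥ-+ {x = x} {y} x≥L y≥L = ≤∞-trans (min∞-greatest x≥L y≥L) (v-add x y)

  ≥ᵥ-neg : ∀ {L x} → x ≥ᵥ L → (- x) ≥ᵥ L
  ≥ᵥ-neg {L} {x} = ≡.subst (fin L ≤∞_) (≡.sym (v-neg x))

  ≥ᵥ-∑ : ∀ {L} k (f : Fin k → Carrier) → (∀ i → f i ≥ᵥ L) → ∑ F k f ≥ᵥ L
  ≥ᵥ-∑ {L} zero    f _   = ≡.subst (fin L ≤∞_) (≡.sym v-zero) ≤∞-top
  ≥ᵥ-∑     (suc k) f f≥L = ≥ᵥ-+ (f≥L zero) (≥ᵥ-∑ k (λ i → f (suc i)) (λ i → f≥L (suc i)))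

  -- v(c·x^E) ≥ L (E ≥ 1) follows from δ + E·w ≥ L for finite v c = δ and
  -- v x = w; infinite valuations only help.
  ≥ᵥ-monomial : ∀ {L} c x E → 1 ℕ.≤ E →
                (∀ {δ w} → v c ≡ fin δ → v x ≡ fin w → L ℤ.≤ δ ℤ.+ + E ℤ.* w) →
                (c * x ^ E) ≥ᵥ L
  ≥ᵥ-monomial {L} c x (suc e) _ estimate =
    ≡.subst (fin L ≤∞_) (≡.sym (v-mul c (x ^ suc e))) (bound ≡.refl ≡.refl)
    where
    bound : ∀ {γ ω} → v c ≡ γ → v x ≡ ω → fin L ≤∞ γ +∞ v (x ^ suc e)
    bound {γ}     {∞}     _  vx = ≡.subst (λ y → fin L ≤∞ γ +∞ y) (≡.sym (v-pow-∞ x e vx))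
                                    (≡.subst (fin L ≤∞_) (≡.sym (+∞-absorbʳ γ)) ≤∞-top)
    bound {∞}     {fin w} _  _  = ≤∞-top
    bound {fin δ} {fin w} vc vx = ≡.subst (λ y → fin L ≤∞ fin δ +∞ y) (≡.sym (v-pow x (suc e) vx))
                                    (fin≤fin (estimate vc vx))

module PPolynomial {c ℓ} (F : Field c ℓ) {p : ℕ} (char : HasCharacteristic F p)
  (v : Field.Carrier F → ℤ∞) (valuation : IsDiscreteValuation F v)
  (m′ n : ℕ) (cs : Fin (suc n) → Field.Carrier F) (cc : Fin (suc n) → Fin m′ → Field.Carrier F)
  (basis : IsValuationBasisOverPow F v (p ℕ.^ suc m′) (suc n) cs) where
  open Field F hiding (zero)
  open IsDiscreteValuation valuation
  open IsValuationBasisOverPow basis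
  open FieldFacts F
  open ValuationFacts F v valuation
  open RingIdentities commutativeRing
  open PowersOf p (characteristic>1 char)
  open import Relation.Binary.Reasoning.Setoid setoid

  P : (Fin (suc n) → Carrier) → Carrier
  P = pPoly F p (suc m′) n cs cc

  q : ℕ
  q = p ℕ.^ suc m′

  -- the exponent p^(m-j) of the coefficient c_ij, where j = toℕ j′ + 1
  lowerExponent : Fin m′ → ℕ
  lowerExponent j′ = p ℕ.^ (m′ ∸ toℕ j′)

  leadingPart : (Fin (suc n) → Carrier) → Carrier
  leadingPart t = ∑ F (suc n) (λ i → cs i * t i ^ q)

  lowerPart : (Fin (suc n) → Carrier) → Carrier
  lowerPart t = ∑ F (suc n) (λ i → ∑ F m′ (λ j → cc i j * t i ^ lowerExponent j))

  -- Each monomial a·T^(p^k) is additive by the Frobenius, hence so is P.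
  monomial-additive : ∀ k a x y → a * (x + y) ^ (p ℕ.^ k) ≈ a * x ^ (p ℕ.^ k) + a * y ^ (p ℕ.^ k)
  monomial-additive k a x y = trans (*-congˡ (frobenius-pow char k x y)) (distribˡ a _ _)

  P-additive : ∀ s t → P (λ i → s i + t i) ≈ P s + P t
  P-additive s t = begin
    P (λ i → s i + t i)
      ≈⟨ +-cong (+-cong
           (∑-split (suc n) _ _ _ (λ i → monomial-additive (suc m′) (cs i) (s i) (t i)))
           (∑-split (suc n) _ _ _ (λ i → ∑-split m′ _ _ _ (λ j →
              monomial-additive (m′ ∸ toℕ j) (cc i j) (s i) (t i)))))
           refl ⟩
    ((leadingPart s + leadingPart t) + (lowerPart s + lowerPart t)) + (s zero + t zero)
      ≈⟨ interchange₃ _ _ _ _ _ _ ⟩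
    P s + P t ∎

  shift : ∀ a s t → (a - P s) - P t ≈ a - P (λ i → s i + t i)
  shift a s t = sym (trans (+-congˡ (-‿cong (P-additive s t))) (sub-sum a (P s) (P t)))

  cannot-improve : ∀ a s {z} → (∀ t → v (a - P t) ≤∞ fin z) →
                   ¬ (∃ λ t → ((a - P s) - P t) ≥ᵥ (z ℤ.+ + 1))
  cannot-improve a s {z} maximal (t , improved) =
    z+1≰z z (fin-≤∞⁻¹ (≤∞-trans (≥ᵥ-cong (shift a s t) improved) (maximal (λ i → s i + t i))))

  rowBound : Fin (suc n) → ℕ
  rowBound i = ∣ v (cs i) ∣∞ ℕ.⊔ proj₁ (finite-bound m′ (λ j → ∣ v (cc i j) ∣∞))

  K : ℕ
  K = proj₁ (finite-bound (suc n) rowBound)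

  cs-bounded : ∀ i → ∣ v (cs i) ∣∞ ℕ.≤ K
  cs-bounded i = ℕP.≤-trans (ℕP.m≤m⊔n _ _) (proj₂ (finite-bound (suc n) rowBound) i)

  cc-bounded : ∀ i j → ∣ v (cc i j) ∣∞ ℕ.≤ K
  cc-bounded i j = ℕP.≤-trans (proj₂ (finite-bound m′ (λ j → ∣ v (cc i j) ∣∞)) j)
                     (ℕP.≤-trans (ℕP.m≤n⊔m _ _) (proj₂ (finite-bound (suc n) rowBound) i))

  1-bounded : ∣ v 1# ∣∞ ℕ.≤ K
  1-bounded = ≡.subst (λ y → ∣ y ∣∞ ℕ.≤ K) (≡.sym v-1) z≤n

  -- The basis elements c_i are nonzero, so their valuations are finite.
  cs-valuation : ∀ i → ∃ λ γ → (v (cs i) ≡ fin γ) × (γ ℤ.≤ + K)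
  cs-valuation i = finite (v (cs i)) ≡.refl
    where
    finite : ∀ x → v (cs i) ≡ x → ∃ λ γ → (v (cs i) ≡ fin γ) × (γ ℤ.≤ + K)
    finite (fin γ) vc = γ , vc , ∣∣≤⇒≤ (≡.subst (λ y → ∣ y ∣∞ ℕ.≤ K) vc (cs-bounded i))
    finite ∞       vc = ⊥-elim (nonzero i (v-∞ (cs i) vc))

  monomial-large : ∀ {z} a x E → upperThreshold K ℤ.≤ z → ∣ v a ∣∞ ℕ.≤ K → 2 ℕ.≤ E →
                   fin z ≤∞ v x → (a * x ^ E) ≥ᵥ (z ℤ.+ + 1)
  monomial-large {z} a x E z≥β a-bounded 2≤E x≥z =
    ≥ᵥ-monomial a x E (ℕP.≤-trans (s≤s z≤n) 2≤E) λ va vx →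
      upper-estimate K (+≤+ 2≤E) z≥β (fin-≤∞⁻¹ (≡.subst (fin z ≤∞_) vx x≥z))
        (fin-≤∞⁻¹ (≡.subst (fin (ℤ.- + K) ≤∞_) va (∣∣≤⇒≥- (v a) a-bounded)))

  monomial-small : ∀ {z} a x i E → z ℤ.≤ lowerThreshold K → ∣ v a ∣∞ ℕ.≤ K → 1 ℕ.≤ E →
                   2 ℕ.* E ℕ.≤ q → fin z ≤∞ v (x ^ q * cs i) → (a * x ^ E) ≥ᵥ (z ℤ.+ + 1)
  monomial-small {z} a x i E z≤α a-bounded 1≤E 2E≤q term≥z with cs-valuation i
  ... | γ , vc , γ≤K = ≥ᵥ-monomial a x E 1≤E λ {δ} {w} va vx →
    lower-estimate K (0≤+ E) (≡.subst (ℤ._≤ + q) (ℤP.pos-* 2 E) (+≤+ 2E≤q))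
      (fin-≤∞⁻¹ (≡.subst (fin z ≤∞_) (≡.trans (v-mul (x ^ q) (cs i)) (≡.cong₂ _+∞_ (v-pow x q vx) vc)) term≥z))
      γ≤K (fin-≤∞⁻¹ (≡.subst (fin (ℤ.- + K) ≤∞_) va (∣∣≤⇒≥- (v a) a-bounded))) z≤α

  single : Carrier → Fin (suc n) → Carrier
  single b zero    = b
  single b (suc _) = 0#

  -- If v b = z ≥ upperThreshold K, then b - P(b, 0, …, 0) = -(sum of monomials
  -- in b and 0) has valuation > z.
  improve-large : ∀ b {z} → v b ≡ fin z → upperThreshold K ℤ.≤ z →
                  ∃ λ t → (b - P t) ≥ᵥ (z ℤ.+ + 1)
  improve-large b {z} vb z≥β =
    single b , ≥ᵥ-cong (sym (sub-cancelʳ (leadingPart (single b)) (lowerPart (single b)) b))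
                 (≥ᵥ-neg (≥ᵥ-+ leading lower))
    where
    entries≥z : ∀ i → fin z ≤∞ v (single b i)
    entries≥z zero    = ≡.subst (fin z ≤∞_) (≡.sym vb) ≤∞-refl
    entries≥z (suc i) = ≡.subst (fin z ≤∞_) (≡.sym v-zero) ≤∞-top
    leading : leadingPart (single b) ≥ᵥ (z ℤ.+ + 1)
    leading = ≥ᵥ-∑ (suc n) _ λ i →
      monomial-large (cs i) (single b i) q z≥β (cs-bounded i) (2≤pow (suc m′) (s≤s z≤n)) (entries≥z i)
    lower : lowerPart (single b) ≥ᵥ (z ℤ.+ + 1)
    lower = ≥ᵥ-∑ (suc n) _ λ i → ≥ᵥ-∑ m′ _ λ j →
      monomial-large (cc i j) (single b i) (lowerExponent j) z≥β (cc-bounded i j)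
        (2≤pow (m′ ∸ toℕ j) (ℕP.m<n⇒0<n∸m (toℕ<n j))) (entries≥z i)

  -- If v b = z ≤ lowerThreshold K, write b = ∑ a_i^q c_i; by valuation
  -- independence every term has valuation ≥ z, and b - P a = -(lowerPart a + a₁)
  -- has valuation > z.
  improve-small : ∀ b {z} → v b ≡ fin z → z ℤ.≤ lowerThreshold K →
                  ∃ λ t → (b - P t) ≥ᵥ (z ℤ.+ + 1)
  improve-small b {z} vb z≤α with spanning b
  ... | a , b≈∑ = a , ≥ᵥ-cong b-Pa (≥ᵥ-neg (≥ᵥ-+ lower constant))
    where
    terms≥z : ∀ i → fin z ≤∞ v (a i ^ q * cs i)
    terms≥z i = ≡.subst (_≤∞ v (a i ^ q * cs i))
      (≡.trans (≡.sym (valIndep a)) (≡.trans (≡.sym (v-cong b≈∑)) vb))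
      (minOver-≤ (suc n) (λ i → v (a i ^ q * cs i)) i)
    b≈leading : b ≈ leadingPart a
    b≈leading = trans b≈∑ (∑-cong (suc n) _ _ (λ i → *-comm (a i ^ q) (cs i)))
    b-Pa : - (lowerPart a + a zero) ≈ b - P a
    b-Pa = sym (trans (+-congʳ b≈leading) (sub-cancelˡ (leadingPart a) (lowerPart a) (a zero)))
    lower : lowerPart a ≥ᵥ (z ℤ.+ + 1)
    lower = ≥ᵥ-∑ (suc n) _ λ i → ≥ᵥ-∑ m′ _ λ j →
      monomial-small (cc i j) (a i) i (lowerExponent j) z≤α (cc-bounded i j) (1≤pow (m′ ∸ toℕ j))
        (double-pow≤ (ℕP.<⇒≤ (toℕ<n j))) (terms≥z i)
    constant : a zero ≥ᵥ (z ℤ.+ + 1)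
    constant = ≥ᵥ-cong (sym (as-monomial (a zero)))
      (monomial-small 1# (a zero) zero 1 z≤α 1-bounded ℕP.≤-refl (2≤pow (suc m′) (s≤s z≤n)) (terms≥z zero))

  maximum-bounded : ∀ a μ → IsMaxValue F v P a μ →
    ((fin (lowerThreshold K) ≤∞ μ) × (μ ≤∞ fin (upperThreshold K))) ⊎ (μ ≡ ∞)
  maximum-bounded a ∞       _                        = inj₂ ≡.refl
  maximum-bounded a (fin z) ((s , attained) , maximal)
    with ℤP.≤-total z (lowerThreshold K) | ℤP.≤-total (upperThreshold K) z
  ... | inj₁ z≤α | _        = ⊥-elim (cannot-improve a s maximal (improve-small _ attained z≤α))
  ... | inj₂ _   | inj₁ β≤z = ⊥-elim (cannot-improve a s maximal (improve-large _ attained β≤z))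
  ... | inj₂ α≤z | inj₂ z≤β = inj₁ (fin≤fin α≤z , fin≤fin z≤β)

lemma1 : ∀ {c ℓ} (F : Field c ℓ) → let open Field F using (Carrier) in
    (p : ℕ) → HasCharacteristic F p →
    (v : Carrier → ℤ∞) → IsDiscreteValuation F v →
    (m n : ℕ) → 1 ℕ.≤ m →
    (cs : Fin (suc n) → Carrier) → (cc : Fin (suc n) → Fin (m ∸ 1) → Carrier) →
    IsValuationBasisOverPow F v (p ℕ.^ m) (suc n) cs →
    ∃ λ (α : ℤ) → ∃ λ (β : ℤ) → (α ℤ.≤ β) ×
      (∀ (a : Carrier) (μ : ℤ∞) → IsMaxValue F v (pPoly F p m n cs cc) a μ →
        ((fin α ≤∞ μ) × (μ ≤∞ fin β)) ⊎ (μ ≡ ∞))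
lemma1 F p char v valuation m n 1≤m cs cc basis with 1≤m
... | s≤s {n = m′} z≤n =
  lowerThreshold K , upperThreshold K , thresholds-ordered K , maximum-bounded
  where open PPolynomial F char v valuation m′ n cs cc basis
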